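{- Let $\Gamma$ be a girth-regular graph of valence $k$, girth $2d+1$ and signature $(a_1,\ldots,a_k)$ such that $a_k=(k-1)^d$. If $uv$ is an edge of $\Gamma$ with $\epsilon(uv)=a_k$, then for every integer $i\ge d$ the sets $D_i^{i+1}(u,v)$ and $D_{i+1}^{i}(u,v)$ are empty.
   Context: Graphs are finite and simple. For a graph of finite girth $g$, a girth cycle is a cycle of length $g$, and $\epsilon(e)$ is the number of girth cycles containing the edge $e$. The signature of a vertex $v$ with incident edges $e_1,\ldots,e_k$ ordered so that $\epsilon(e_1)\le\cdots\le\epsilon(e_k)$ is $(\epsilon(e_1),\ldots,\epsilon(e_k))$; a graph is girth-regular if all vertices have the same signature (the signature of the graph). For a vertex $w$ and integer $i$, $S_i(w)$ is the set of vertices at distance $i$ from $w$, and for an edge $uv$, $D^i_j(u,v)=S_i(u)\cap S_j(v)$. -}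

module Defs where

open import Data.Nat using (ℕ; zero; suc; _+_; _∸_; _^_; _<_; _≤_)
open import Data.Nat.Properties using (≤-decTotalOrder)
open import Data.Bool using (Bool; true; false; _∧_; not; T?)
open import Data.Fin using (Fin; _≟_)
open import Data.List using (List; []; _∷_; length; filter; map; concatMap; allFin; last)
open import Data.Bool.ListAction using (any)
open import Data.Maybe using (Maybe; just; nothing)
open import Data.Product using (_×_; Σ; ∃)
open import Relation.Nullary using (¬_)
open import Relation.Nullary.Decidable using (⌊_⌋)
open import Relation.Binary.PropositionalEquality using (_≡_)
open import Data.List.Sort ≤-decTotalOrder using (sort)

record Graph (n : ℕ) : Set where
  field
    adj    : Fin n → Fin n → Bool
    sym    : ∀ x y → adj x y ≡ adj y x
    irrefl : ∀ x → adj x x ≡ false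

module _ {n : ℕ} (G : Graph n) where
  open Graph G

  allLists : ℕ → List (List (Fin n))
  allLists zero    = [] ∷ []
  allLists (suc ℓ) = concatMap (λ x → map (x ∷_) (allLists ℓ)) (allFin n)

  distinctB : List (Fin n) → Bool
  distinctB []       = true
  distinctB (x ∷ xs) = not (any (λ y → ⌊ x ≟ y ⌋) xs) ∧ distinctB xs

  pathB : List (Fin n) → Bool
  pathB []           = true
  pathB (x ∷ [])     = true
  pathB (x ∷ y ∷ xs) = adj x y ∧ pathB (y ∷ xs)

  closeB : List (Fin n) → Bool
  closeB []       = false
  closeB (x ∷ xs) with last (x ∷ xs)
  ... | just y  = adj y x
  ... | nothing = false

  isCycleB : List (Fin n) → Bool
  isCycleB xs = distinctB xs ∧ pathB xs ∧ closeB xs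

  IsCycle : ℕ → List (Fin n) → Set
  IsCycle ℓ xs = (3 ≤ ℓ) × (length xs ≡ ℓ) × (isCycleB xs ≡ true)

  HasGirth : ℕ → Set
  HasGirth g = (∃ λ xs → IsCycle g xs) × (∀ ℓ xs → ℓ < g → ¬ IsCycle ℓ xs)

  -- ε(uv) w.r.t. cycle length g: number of cycles of length g through the edge uv.
  -- Each such cycle corresponds to exactly one cyclic sequence u, v, v₂, …, v_{g-1}.
  eps : ℕ → Fin n → Fin n → ℕ
  eps g u v = length (filter (λ ws → T? (isCycleB (u ∷ v ∷ ws))) (allLists (g ∸ 2)))

  neighbours : Fin n → List (Fin n)
  neighbours v = filter (λ w → T? (adj v w)) (allFin n)

  degree : Fin n → ℕ
  degree v = length (neighbours v)

  signature : ℕ → Fin n → List ℕ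
  signature g v = sort (map (eps g v) (neighbours v))

  GirthRegularWith : ℕ → List ℕ → Set
  GirthRegularWith g a = HasGirth g × (∀ v → signature g v ≡ a)

  Regular : ℕ → Set
  Regular k = ∀ v → degree v ≡ k

  data Walk : Fin n → Fin n → ℕ → Set where
    here : ∀ {x} → Walk x x 0
    step : ∀ {x y z ℓ} → adj x y ≡ true → Walk y z ℓ → Walk x z (suc ℓ)

  Dist : Fin n → Fin n → ℕ → Set
  Dist x y i = Walk x y i × (∀ j → j < i → ¬ Walk x y j)

  -- w ∈ D^i_j(u,v) = S_i(u) ∩ S_j(v)
  InD : ℕ → ℕ → Fin n → Fin n → Fin n → Set
  InD i j u v w = Dist u w i × Dist v w j

module Submission where

-- Let Γ have girth g = 2d+1 and valence k, and let uv be an edge on ε(uv) = (k-1)^d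
-- girth cycles (only this is used of the signature hypothesis).  Suppose w ∈ D^{i+1}_i(u,v) with i ≥ d (the other set is symmetric,
-- with the girth cycles read backwards).  Every girth cycle u, v, z₁, …, z_{2d-1}
-- yields the non-backtracking walk z₁ … z_d leaving v away from u, and
--   * this prefix determines the cycle: two different returns z_d … u of length d
--     would close a cycle of length ≤ 2d < g;
--   * the end z_d of the prefix is at distance d from u (along the rest of the cycle).
-- The first d steps of a shortest walk from v to w also form such a walk, but it is
-- not a cycle prefix: otherwise u reaches w in d + (i - d) = i < i + 1 steps.
-- As there are at most (k-1)^d non-backtracking walks of length d, fewer than (k-1)^d
-- girth cycles contain uv — a contradiction.

open import Defs
open import Data.Bool using (true; false; T; T?; not)
open import Data.Bool.ListAction using (any)
open import Data.Bool.Properties using (T-≡; T-∧)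
open import Data.Empty using (⊥; ⊥-elim)
open import Data.Fin using (Fin; _≟_)
open import Data.List
  using (List; []; _∷_; _++_; _∷ʳ_; [_]; length; map; concatMap; filter; reverse; take; drop; head; last; allFin)
open import Data.List.Properties
  using (length-++; length-map; length-reverse; length-take; length-drop; take++drop≡id;
         unfold-reverse; reverse-injective; ∷-injectiveˡ; ∷-injectiveʳ; ∷ʳ-injectiveˡ; ≡-dec; filter-notAll)
open import Data.List.Membership.Propositional using (_∈_; _∉_)
open import Data.List.Membership.Propositional.Properties
  using (∈-∃++; ∈-allFin; ∈-++⁺ˡ; ∈-++⁺ʳ; ∈-++⁻; ∈-map⁺; ∈-map⁻; ∈-filter⁺; ∈-filter⁻; ∈-concatMap⁺; ∈-concatMap⁻)
open import Data.List.Relation.Unary.Any using (Any; here; there; satisfied)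
import Data.List.Relation.Unary.Any as Any
open import Data.List.Relation.Unary.Any.Properties using (any⁺; any⁻; reverse⁻)
open import Data.List.Relation.Unary.All using (All; []; _∷_; lookup; tabulate)
import Data.List.Relation.Unary.All.Properties as All
import Data.List.Relation.Unary.AllPairs as AllPairs
import Data.List.Relation.Unary.AllPairs.Properties as AllPairs
open import Data.List.Relation.Unary.Unique.Propositional using (Unique; _∷_; [])
import Data.List.Relation.Unary.Unique.Propositional.Properties as Unique
open import Data.List.Relation.Binary.Disjoint.Propositional using (Disjoint)
open import Data.List.Relation.Binary.Subset.Propositional using (_⊆_)
open import Data.List.Relation.Binary.Permutation.Propositional using (_↭_; swap; ↭-sym; ↭⇒↭ₛ)
open import Data.List.Relation.Binary.Permutation.Propositional.Properties
  using (shift; ↭-length; ∈-resp-↭; ↭-reverse; ∷↭∷ʳ)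
import Data.List.Relation.Binary.Permutation.Setoid.Properties as PermutationProperties
import Data.List.Relation.Unary.First as First
open import Data.List.Relation.Unary.First.Properties using (¬All⇒First; toView)
open import Data.Maybe using (just)
open import Data.Maybe.Properties using (just-injective)
open import Data.Nat using (ℕ; zero; suc; _+_; _*_; _∸_; _^_; _≤_; _<_; z≤n; s≤s)
open import Data.Nat.Properties
  using (≤-refl; ≤-trans; ≤-reflexive; <-irrefl; +-mono-≤; *-monoˡ-≤; ∸-monoˡ-≤; m≤m+n; n≤1+n;
         m≤n⇒m⊓n≡m; m+n∸m≡n; m+n∸n≡m; +-suc; m+[n∸m]≡n; +-comm; module ≤-Reasoning)
open import Data.Nat.Tactic.RingSolver using (solve-∀)
open import Data.Product using (∃; ∃₂; _×_; _,_; proj₁; proj₂)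
open import Data.Sum using (inj₁; inj₂)
open import Data.Unit using (⊤; tt)
open import Function using (_∘_; Equivalence)
open import Relation.Binary.Definitions using (DecidableEquality)
open import Relation.Binary.PropositionalEquality
  using (_≡_; _≢_; refl; sym; trans; cong; cong₂; subst; subst₂; setoid; ≢-sym; module ≡-Reasoning)
open import Relation.Nullary using (¬_; ¬?; yes; no; contradiction)
open import Relation.Nullary.Decidable using (⌊_⌋; toWitness; fromWitness; decidable-stable)

module _ {A : Set} where

  unique-resp-↭ : ∀ {xs ys : List A} → xs ↭ ys → Unique xs → Unique ys
  unique-resp-↭ xs↭ys = Unique-resp-↭ (↭⇒↭ₛ xs↭ys)
    where open PermutationProperties (setoid A) using (Unique-resp-↭)

  unique-∷ : ∀ {x : A} {xs} → x ∉ xs → Unique xs → Unique (x ∷ xs)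
  unique-∷ {xs = xs} x∉xs u = All.¬Any⇒All¬ xs x∉xs ∷ u

  unique-++ˡ : ∀ (xs : List A) {ys} → Unique (xs ++ ys) → Unique xs
  unique-++ˡ []       _        = []
  unique-++ˡ (x ∷ xs) (x∉ ∷ u) = All.++⁻ˡ xs x∉ ∷ unique-++ˡ xs u

  unique-middle : ∀ (xs : List A) {z ys} → Unique (xs ++ z ∷ ys) → z ∉ xs
  unique-middle (x ∷ xs) (x∉ ∷ _) (here refl) = lookup x∉ (∈-++⁺ʳ xs (here refl)) refl
  unique-middle (x ∷ xs) (_ ∷ u)  (there z∈) = unique-middle xs u z∈

  unique-map-on : ∀ {B : Set} (f : A → B) {xs} → (∀ {x y} → x ∈ xs → y ∈ xs → f x ≡ f y → x ≡ y) →
    Unique xs → Unique (map f xs)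
  unique-map-on f {[]}     _   []       = []
  unique-map-on f {x ∷ xs} inj (x∉ ∷ u) =
    All.map⁺ (tabulate λ y∈ fx≡fy → lookup x∉ y∈ (inj (here refl) (there y∈) fx≡fy)) ∷
    unique-map-on f (λ x∈ y∈ → inj (there x∈) (there y∈)) u

  unique-⊆-length : ∀ {xs ys : List A} → Unique xs → xs ⊆ ys → length xs ≤ length ys
  unique-⊆-length {[]}     _          _   = z≤n
  unique-⊆-length {x ∷ xs} {ys} (x∉ ∷ u) xs⊆ys
    with ys₁ , ys₂ , refl ← ∈-∃++ (xs⊆ys (here refl)) =
    ≤-trans (s≤s (unique-⊆-length u xs⊆rest)) (≤-reflexive (sym (↭-length (shift x ys₁ ys₂))))
    where
      xs⊆rest : xs ⊆ ys₁ ++ ys₂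
      xs⊆rest {t} t∈xs with ∈-resp-↭ (shift x ys₁ ys₂) (xs⊆ys (there t∈xs))
      ... | here t≡x  = contradiction (sym t≡x) (lookup x∉ t∈xs)
      ... | there t∈ = t∈

  unique-⊂-length : ∀ {xs ys : List A} {y} → Unique xs → xs ⊆ ys → y ∈ ys → y ∉ xs →
    length xs < length ys
  unique-⊂-length u xs⊆ys y∈ys y∉xs =
    unique-⊆-length (unique-∷ y∉xs u) λ { (here refl) → y∈ys ; (there t∈) → xs⊆ys t∈ }

  length-concatMap-≤ : ∀ {B : Set} (f : A → List B) (xs : List A) {b} →
    (∀ {x} → x ∈ xs → length (f x) ≤ b) → length (concatMap f xs) ≤ length xs * b
  length-concatMap-≤ f []       _     = z≤n
  length-concatMap-≤ f (x ∷ xs) bound =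
    ≤-trans (≤-reflexive (length-++ (f x)))
            (+-mono-≤ (bound (here refl)) (length-concatMap-≤ f xs (λ x∈ → bound (there x∈))))

  first-common : DecidableEquality A → ∀ (xs ys : List A) → Any (_∈ ys) xs →
    ∃₂ λ r z → ∃ λ r' → xs ≡ r ++ z ∷ r' × z ∈ ys × All (_∉ ys) r
  first-common _≟ᴬ_ xs ys common
    with toView (¬All⇒First (λ t → ¬? (t ∈? ys)) (decidable-stable (_ ∈? ys)) (λ none → All.All¬⇒¬Any none common))
    where open import Data.List.Membership.DecPropositional _≟ᴬ_ using (_∈?_)
  ... | First._++_∷_ r∉ys z∈ys r' = _ , _ , r' , refl , z∈ys , r∉ys

  -- Length bookkeeping for the cycle x, r, z, reverse s built from x, r, z, r' and x, s, z, s'.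
  meeting-length : ∀ (x z : A) r r' s s' → 1 ≤ length r + length s →
    3 ≤ length (x ∷ r ++ z ∷ reverse s) ×
    length (x ∷ r ++ z ∷ reverse s) ≤ length (r ++ z ∷ r') + length (s ++ z ∷ s')
  meeting-length x z r r' s s' nontrivial =
    subst (3 ≤_) (sym cycle-length) (s≤s (s≤s nontrivial)) , (begin
      length (x ∷ r ++ z ∷ reverse s)                         ≡⟨ cycle-length ⟩
      2 + (length r + length s)                               ≤⟨ m≤m+n _ (length r' + length s') ⟩
      (2 + (length r + length s)) + (length r' + length s')   ≡⟨ sym (detours (length r) (length s) (length r') (length s')) ⟩
      (length r + suc (length r')) + (length s + suc (length s')) ≡⟨ sym (cong₂ _+_ (length-++ r) (length-++ s)) ⟩
      length (r ++ z ∷ r') + length (s ++ z ∷ s')             ∎)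
    where
      open ≤-Reasoning

      cycle-length : length (x ∷ r ++ z ∷ reverse s) ≡ 2 + (length r + length s)
      cycle-length = cong suc (trans (length-++ r)
        (trans (cong (λ m → length r + suc m) (length-reverse s)) (+-suc (length r) (length s))))

      detours : ∀ a b c e → (a + suc c) + (b + suc e) ≡ (2 + (a + b)) + (c + e)
      detours = solve-∀

  meet : ∀ {t : A} {xs ys} → t ∈ xs → t ∈ ys → Any (_∈ ys) xs
  meet t∈xs t∈ys = Any.map (λ t≡ → subst (_∈ _) t≡ t∈ys) t∈xs

module Paths {n : ℕ} (G : Graph n) where

  V : Set
  V = Fin n

  Adj : V → V → Set
  Adj x y = Graph.adj G x y ≡ true

  adj-sym : ∀ {x y} → Adj x y → Adj y x
  adj-sym {x} {y} xy = trans (Graph.sym G y x) xy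

  -- Walks are vertex lists: x, xs is a chain when consecutive vertices are adjacent;
  -- it is a path when moreover x ∷ xs is duplicate-free.
  Chain : V → List V → Set
  Chain x []       = ⊤
  Chain x (y ∷ ys) = Adj x y × Chain y ys

  endpoint : V → List V → V
  endpoint x []       = x
  endpoint x (y ∷ ys) = endpoint y ys

  endpoint-∈ : ∀ x xs → endpoint x xs ∈ x ∷ xs
  endpoint-∈ x []       = here refl
  endpoint-∈ x (y ∷ ys) = there (endpoint-∈ y ys)

  endpoint-++ : ∀ x xs ys → endpoint x (xs ++ ys) ≡ endpoint (endpoint x xs) ys
  endpoint-++ x []       ys = refl
  endpoint-++ x (y ∷ xs) ys = endpoint-++ y xs ys

  endpoint-∷ʳ : ∀ x xs y → endpoint x (xs ∷ʳ y) ≡ y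
  endpoint-∷ʳ x xs y = endpoint-++ x xs [ y ]

  -- The cycle x, xs, x (its length ≥ 3 is recorded separately where needed).
  Cycle : V → List V → Set
  Cycle x xs = Unique (x ∷ xs) × Chain x xs × Adj (endpoint x xs) x

  HasCycleWithin : ℕ → Set
  HasCycleWithin ℓ = ∃₂ λ x xs → Cycle x xs × 3 ≤ length (x ∷ xs) × length (x ∷ xs) ≤ ℓ

  within-mono : ∀ {ℓ ℓ'} → ℓ ≤ ℓ' → HasCycleWithin ℓ → HasCycleWithin ℓ'
  within-mono ℓ≤ℓ' (x , xs , cyc , long , short) = x , xs , cyc , long , ≤-trans short ℓ≤ℓ'

  chain-++⁻ : ∀ x xs ys → Chain x (xs ++ ys) → Chain x xs × Chain (endpoint x xs) ys
  chain-++⁻ x []       ys c        = tt , c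
  chain-++⁻ x (y ∷ xs) ys (xy , c) = let (c₁ , c₂) = chain-++⁻ y xs ys c in (xy , c₁) , c₂

  chain-++⁺ : ∀ x xs ys → Chain x xs → Chain (endpoint x xs) ys → Chain x (xs ++ ys)
  chain-++⁺ x []       ys _         c₂ = c₂
  chain-++⁺ x (y ∷ xs) ys (xy , c₁) c₂ = xy , chain-++⁺ y xs ys c₁ c₂

  chain-reverse : ∀ x s {z} → Chain x s → Adj (endpoint x s) z →
    Chain z (reverse s) × Adj (endpoint z (reverse s)) x
  chain-reverse x []      _         xz = tt , adj-sym xz
  chain-reverse x (t ∷ s) {z} (xt , c) tz rewrite unfold-reverse t s =
    let (c' , tx) = chain-reverse t s c tz in
    chain-++⁺ z (reverse s) [ t ] c' (tx , tt) ,
    subst (λ e → Adj e x) (sym (endpoint-∷ʳ z (reverse s) t)) (adj-sym xt)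

  private
    T-not⁻ : ∀ {b} → T (not b) → ¬ T b
    T-not⁻ {false} _ ()

    T-not⁺ : ∀ {b} → ¬ T b → T (not b)
    T-not⁺ {false} _  = tt
    T-not⁺ {true}  ¬t = ¬t tt

  fresh⁻ : ∀ (x : V) xs → T (not (any (λ y → ⌊ x ≟ y ⌋) xs)) → x ∉ xs
  fresh⁻ x xs fresh x∈xs = T-not⁻ fresh (any⁺ _ (Any.map fromWitness x∈xs))

  fresh⁺ : ∀ (x : V) xs → x ∉ xs → T (not (any (λ y → ⌊ x ≟ y ⌋) xs))
  fresh⁺ x xs x∉xs = T-not⁺ λ t → x∉xs (Any.map toWitness (any⁻ _ xs t))

  distinct⁻ : ∀ xs → T (distinctB G xs) → Unique xs
  distinct⁻ []       _ = []
  distinct⁻ (x ∷ xs) t =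
    let (f , d) = Equivalence.to T-∧ t in unique-∷ (fresh⁻ x xs f) (distinct⁻ xs d)

  distinct⁺ : ∀ xs → Unique xs → T (distinctB G xs)
  distinct⁺ []       _            = tt
  distinct⁺ (x ∷ xs) u@(_ ∷ u') =
    Equivalence.from T-∧ (fresh⁺ x xs (Unique.Unique[x∷xs]⇒x∉xs u) , distinct⁺ xs u')

  chain⁻ : ∀ x xs → T (pathB G (x ∷ xs)) → Chain x xs
  chain⁻ x []       _ = tt
  chain⁻ x (y ∷ ys) t = let (a , c) = Equivalence.to T-∧ t in Equivalence.to T-≡ a , chain⁻ y ys c

  chain⁺ : ∀ x xs → Chain x xs → T (pathB G (x ∷ xs))
  chain⁺ x []       _        = tt
  chain⁺ x (y ∷ ys) (xy , c) = Equivalence.from T-∧ (Equivalence.from T-≡ xy , chain⁺ y ys c)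

  last-endpoint : ∀ x xs → last (x ∷ xs) ≡ just (endpoint x xs)
  last-endpoint x []       = refl
  last-endpoint x (y ∷ ys) = last-endpoint y ys

  closeB-endpoint : ∀ x xs → closeB G (x ∷ xs) ≡ Graph.adj G (endpoint x xs) x
  closeB-endpoint x xs rewrite last-endpoint x xs = refl

  cycle⁻ : ∀ x xs → T (isCycleB G (x ∷ xs)) → Cycle x xs
  cycle⁻ x xs t =
    let (d , pc) = Equivalence.to T-∧ t ; (p , c) = Equivalence.to T-∧ pc in
    distinct⁻ (x ∷ xs) d , chain⁻ x xs p ,
    Equivalence.to T-≡ (subst T (closeB-endpoint x xs) c)

  cycle⁺ : ∀ x xs → Cycle x xs → T (isCycleB G (x ∷ xs))
  cycle⁺ x xs (u , c , close) =
    Equivalence.from T-∧ (distinct⁺ (x ∷ xs) u , Equivalence.from T-∧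
      (chain⁺ x xs c , subst T (sym (closeB-endpoint x xs)) (Equivalence.from T-≡ close)))

  walk-++ : ∀ {x y z ℓ m} → Walk G x y ℓ → Walk G y z m → Walk G x z (ℓ + m)
  walk-++ here         w' = w'
  walk-++ (step xy w) w' = step xy (walk-++ w w')

  walk-reverse : ∀ {x y ℓ} → Walk G x y ℓ → Walk G y x ℓ
  walk-reverse here         = here
  walk-reverse (step xy w) = snoc (walk-reverse w) (adj-sym xy)
    where
      snoc : ∀ {x y z ℓ} → Walk G x y ℓ → Adj y z → Walk G x z (suc ℓ)
      snoc here        yz = step yz here
      snoc (step a w) yz = step a (snoc w yz)

  chain-walk : ∀ x xs → Chain x xs → Walk G x (endpoint x xs) (length xs)
  chain-walk x []       _        = here
  chain-walk x (y ∷ ys) (xy , c) = step xy (chain-walk y ys c)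

  NonBacktracking : V → V → List V → Set
  NonBacktracking a b []       = ⊤
  NonBacktracking a b (y ∷ ys) = Adj b y × y ≢ a × NonBacktracking b y ys

  nonbacktracking-take : ∀ m a b ys → NonBacktracking a b ys → NonBacktracking a b (take m ys)
  nonbacktracking-take zero    a b ys       _              = tt
  nonbacktracking-take (suc m) a b []       _              = tt
  nonbacktracking-take (suc m) a b (y ∷ ys) (by , y≢a , nb) = by , y≢a , nonbacktracking-take m b y ys nb

  path-nonbacktracking : ∀ a b ys → Unique (a ∷ b ∷ ys) → Chain b ys → NonBacktracking a b ys
  path-nonbacktracking a b []       _                           _        = tt
  path-nonbacktracking a b (y ∷ ys) ((_ ∷ a≢y ∷ _) ∷ u) (by , c) =
    by , ≢-sym a≢y , path-nonbacktracking b y ys u c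

  NoWalkBelow : V → V → ℕ → Set
  NoWalkBelow x w ℓ = ∀ j → j < ℓ → ¬ Walk G x w j

  geodesic-prefix : ∀ m r {a b w} → Walk G b w (m + r) → NoWalkBelow b w (m + r) →
    NoWalkBelow a w (suc (m + r)) →
    ∃ λ ys → NonBacktracking a b ys × length ys ≡ m × Walk G (endpoint b ys) w r
  geodesic-prefix zero    r walk _     _     = [] , tt , refl , walk
  geodesic-prefix (suc m) r {a} {b} {w} (step {y = y} by walk) b-far a-far
    with ys , nb , len , rest ← geodesic-prefix m r walk
           (λ j j< walk' → b-far (suc j) (s≤s j<) (step by walk')) b-far =
    y ∷ ys , (by , y≢a , nb) , cong suc len , rest
    where
      -- stepping back to a would give a walk from a to w of length m + r
      y≢a : y ≢ a
      y≢a refl = a-far (m + r) (n≤1+n _) walk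

  -- Paths x, r, z, r' and x, s, z, s' (with r avoiding the second path) close the cycle
  -- x, r, z, reverse s, which is no longer than the two paths together.
  meeting-cycle : ∀ {x z} r r' s s' →
    Unique (x ∷ r ++ z ∷ r') → Unique (x ∷ s ++ z ∷ s') →
    Chain x (r ++ z ∷ r') → Chain x (s ++ z ∷ s') →
    All (_∉ s ++ z ∷ s') r → 1 ≤ length r + length s →
    HasCycleWithin (length (r ++ z ∷ r') + length (s ++ z ∷ s'))
  meeting-cycle {x} {z} r r' s s' up@(_ ∷ up') uq@(_ ∷ uq') cp cq r∉q nontrivial =
    x , r ++ z ∷ reverse s , (unique , chain , closing) , meeting-length x z r r' s s' nontrivial
    where
      to-r = chain-++⁻ x r (z ∷ r') cp
      to-s = chain-++⁻ x s (z ∷ s') cq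
      back = chain-reverse x s (proj₁ to-s) (proj₁ (proj₂ to-s))

      chain : Chain x (r ++ z ∷ reverse s)
      chain = chain-++⁺ x r (z ∷ reverse s) (proj₁ to-r) (proj₁ (proj₂ to-r) , proj₁ back)

      closing : Adj (endpoint x (r ++ z ∷ reverse s)) x
      closing = subst (λ e → Adj e x) (sym (endpoint-++ x r (z ∷ reverse s))) (proj₂ back)

      on-second : ∀ {t} → t ∈ z ∷ reverse s → t ∈ s ++ z ∷ s'
      on-second (here refl) = ∈-++⁺ʳ s (here refl)
      on-second (there t∈)  = ∈-++⁺ˡ (reverse⁻ {xs = s} t∈)

      x∉ : x ∉ r ++ z ∷ reverse s
      x∉ x∈ with ∈-++⁻ r x∈
      ... | inj₁ x∈r = Unique.Unique[x∷xs]⇒x∉xs up (∈-++⁺ˡ x∈r)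
      ... | inj₂ x∈  = Unique.Unique[x∷xs]⇒x∉xs uq (on-second x∈)

      -- x lies on neither path; z ∷ reverse s is duplicate-free; r avoids the second path.
      unique : Unique (x ∷ r ++ z ∷ reverse s)
      unique = unique-∷ x∉ (Unique.++⁺ (unique-++ˡ r up')
        (unique-∷ (unique-middle s uq' ∘ reverse⁻) (unique-resp-↭ (↭-sym (↭-reverse s)) (unique-++ˡ s uq')))
        (λ (t∈r , t∈) → lookup r∉q t∈r (on-second t∈)))

  -- Paths from x whose first steps differ but which meet again: cut p at its first vertex z
  -- on q; then x, r, z and x, s, z close a cycle.
  diverging-cycle : ∀ {x} p q → Unique (x ∷ p) → Unique (x ∷ q) → Chain x p → Chain x q →
    Any (_∈ q) p → head p ≢ head q → HasCycleWithin (length p + length q)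
  diverging-cycle p q up uq cp cq common heads≢
    with r , z , r' , refl , z∈q , r∉q ← first-common _≟_ p q common
    with s , s' , refl ← ∈-∃++ z∈q =
    meeting-cycle r r' s s' up uq cp cq r∉q (nontrivial r s heads≢)
    where
      nontrivial : ∀ r s → head (r ++ z ∷ r') ≢ head (s ++ z ∷ s') → 1 ≤ length r + length s
      nontrivial (_ ∷ _) _       _      = s≤s z≤n
      nontrivial []      (_ ∷ _) _      = s≤s z≤n
      nontrivial []      []      heads≢ = contradiction refl heads≢

  -- Two distinct paths from x with a common endpoint contain a cycle no longer than both
  -- together: strip their common first steps, then apply diverging-cycle.  (A nonempty
  -- path cannot end at its start.)
  two-paths-cycle : ∀ x p q → Unique (x ∷ p) → Unique (x ∷ q) → Chain x p → Chain x q →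
    endpoint x p ≡ endpoint x q → p ≢ q → HasCycleWithin (length p + length q)
  two-paths-cycle x []       []       _          _          _  _  _    p≢q = contradiction refl p≢q
  two-paths-cycle x []       (q₁ ∷ q) _          (x∉q ∷ _) _  _  same _   =
    ⊥-elim (All.All¬⇒¬Any x∉q (subst (_∈ q₁ ∷ q) (sym same) (endpoint-∈ q₁ q)))
  two-paths-cycle x (p₁ ∷ p) []       (x∉p ∷ _) _          _  _  same _   =
    ⊥-elim (All.All¬⇒¬Any x∉p (subst (_∈ p₁ ∷ p) same (endpoint-∈ p₁ p)))
  two-paths-cycle x (p₁ ∷ p) (q₁ ∷ q) up@(_ ∷ up') uq@(_ ∷ uq') cp cq same p≢q with p₁ ≟ q₁
  ... | yes refl = within-mono (+-mono-≤ (n≤1+n _) (n≤1+n _))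
        (two-paths-cycle p₁ p q up' uq' (proj₂ cp) (proj₂ cq) same (p≢q ∘ cong (p₁ ∷_)))
  ... | no p₁≢q₁ = diverging-cycle (p₁ ∷ p) (q₁ ∷ q) up uq cp cq
        (meet (endpoint-∈ p₁ p) (subst (_∈ q₁ ∷ q) (sym same) (endpoint-∈ q₁ q))) (p₁≢q₁ ∘ just-injective)

  cycle-reverse : ∀ a b ws → Cycle a (b ∷ ws) → Cycle b (a ∷ reverse ws)
  cycle-reverse a b ws (u , (ab , c) , close) =
    unique-resp-↭ (↭-sym (swap b a (↭-reverse ws))) u , (adj-sym ab , proj₁ back) , proj₂ back
    where back = chain-reverse b ws c close

  drop-endpoint : ∀ y ys zs → drop (length ys) (y ∷ ys ++ zs) ≡ endpoint y ys ∷ zs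
  drop-endpoint y []       zs = refl
  drop-endpoint y (t ∷ ys) zs = drop-endpoint t ys zs

  cycle-return : ∀ x y ys zs → Cycle x (y ∷ ys ++ zs) →
    Unique (endpoint y ys ∷ zs ∷ʳ x) × Chain (endpoint y ys) (zs ∷ʳ x)
  cycle-return x y ys zs (x∉ ∷ u , (_ , c) , close) =
    unique-resp-↭ (∷↭∷ʳ x (endpoint y ys ∷ zs))
      (subst (All (x ≢_)) suffix (All.drop⁺ (length ys) x∉) ∷ subst Unique suffix (Unique.drop⁺ (length ys) u)) ,
    chain-++⁺ (endpoint y ys) zs [ x ] (proj₂ (chain-++⁻ y ys zs c))
      (subst (λ e → Adj e x) (endpoint-++ y ys zs) close , tt)
    where suffix = drop-endpoint y ys zs

module Girth {n : ℕ} (G : Graph n) (d' : ℕ) (girth : ∀ ℓ xs → ℓ < 2 * suc d' + 1 → ¬ IsCycle G ℓ xs) where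
  open Paths G

  d : ℕ
  d = suc d'

  no-short-cycle : ¬ HasCycleWithin (d + d)
  no-short-cycle (x , xs , cyc , long , short) =
    girth (length (x ∷ xs)) (x ∷ xs) (≤-trans (s≤s short) (≤-reflexive (double d)))
      (long , refl , Equivalence.to T-≡ (cycle⁺ x xs cyc))
    where
      double : ∀ m → suc (m + m) ≡ 2 * m + 1
      double = solve-∀

  short-paths-unique : ∀ z p q → Unique (z ∷ p) → Unique (z ∷ q) → Chain z p → Chain z q →
    endpoint z p ≡ endpoint z q → length p ≤ d → length q ≤ d → p ≡ q
  short-paths-unique z p q up uq cp cq same p≤d q≤d with ≡-dec _≟_ p q
  ... | yes p≡q = p≡q
  ... | no  p≢q = ⊥-elim (no-short-cycle
        (within-mono (+-mono-≤ p≤d q≤d) (two-paths-cycle z p q up uq cp cq same p≢q)))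

  GirthCycle : V → V → List V → Set
  GirthCycle a b ws = Cycle a (b ∷ ws) × length ws ≡ d + d'

  opposite : V → List V → V
  opposite b ws = endpoint b (take d ws)

  split-cycle : ∀ {a b} ws → Cycle a (b ∷ ws) → Cycle a (b ∷ take d ws ++ drop d ws)
  split-cycle {a} {b} ws = subst (λ zs → Cycle a (b ∷ zs)) (sym (take++drop≡id d ws))

  -- From the opposite vertex, a girth cycle returns to a in d steps, so the opposite vertex
  -- is at distance at most d from a.
  return-length : ∀ ws (a : V) → length ws ≡ d + d' → length (drop d ws ∷ʳ a) ≡ d
  return-length ws a len = begin
    length (drop d ws ++ [ a ]) ≡⟨ length-++ (drop d ws) ⟩
    length (drop d ws) + 1     ≡⟨ cong (_+ 1) (trans (length-drop d ws) (trans (cong (_∸ d) len) (m+n∸m≡n d d'))) ⟩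
    d' + 1                     ≡⟨ +-comm d' 1 ⟩
    d                          ∎
    where open ≡-Reasoning

  opposite-reachable : ∀ {a b ws} → GirthCycle a b ws → Walk G a (opposite b ws) d
  opposite-reachable {a} {b} {ws} (cyc , len) =
    subst₂ (λ x ℓ → Walk G x (opposite b ws) ℓ) (endpoint-∷ʳ _ (drop d ws) a) (return-length ws a len)
      (walk-reverse (chain-walk _ _ (proj₂ (cycle-return a b (take d ws) (drop d ws) (split-cycle ws cyc)))))

  prefix-nonbacktracking : ∀ {a b ws} → GirthCycle a b ws → NonBacktracking a b (take d ws)
  prefix-nonbacktracking {a} {b} {ws} ((u , (_ , c) , _) , _) =
    nonbacktracking-take d a b ws (path-nonbacktracking a b ws u c)

  prefix-length : ∀ {a b ws} → GirthCycle a b ws → length (take d ws) ≡ d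
  prefix-length {ws = ws} (_ , len) =
    trans (length-take d ws) (m≤n⇒m⊓n≡m (subst (d ≤_) (sym len) (m≤m+n d d')))

  girth-cycle-reverse : ∀ {a b ws} → GirthCycle a b ws → GirthCycle b a (reverse ws)
  girth-cycle-reverse {a} {b} {ws} (cyc , len) = cycle-reverse a b ws cyc , trans (length-reverse ws) len

  prefix-determines : ∀ {a b ws ws'} → GirthCycle a b ws → GirthCycle a b ws' →
    take d ws ≡ take d ws' → ws ≡ ws'
  prefix-determines {a} {b} {ws} {ws'} (cyc , len) (cyc' , len') same-prefix = begin
    ws                        ≡⟨ sym (take++drop≡id d ws) ⟩
    take d ws ++ drop d ws    ≡⟨ cong₂ _++_ same-prefix same-return ⟩
    take d ws' ++ drop d ws'  ≡⟨ take++drop≡id d ws' ⟩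
    ws'                       ∎
    where
      open ≡-Reasoning
      back  = cycle-return a b (take d ws) (drop d ws) (split-cycle ws cyc)
      back' = cycle-return a b (take d ws) (drop d ws')
        (subst (λ P → Cycle a (b ∷ P ++ drop d ws')) (sym same-prefix) (split-cycle ws' cyc'))
      -- both cycles return from the same opposite vertex to a along paths of length d
      same-return : drop d ws ≡ drop d ws'
      same-return = ∷ʳ-injectiveˡ (drop d ws) (drop d ws')
        (short-paths-unique _ _ _ (proj₁ back) (proj₁ back') (proj₂ back) (proj₂ back')
          (trans (endpoint-∷ʳ _ (drop d ws) a) (sym (endpoint-∷ʳ _ (drop d ws') a)))
          (≤-reflexive (return-length ws a len)) (≤-reflexive (return-length ws' a len')))

module Counting {n : ℕ} (G : Graph n) (k : ℕ) (regular : Regular G k) where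
  open Paths G

  neighbour⁺ : ∀ {b y} → Adj b y → y ∈ neighbours G b
  neighbour⁺ {b} {y} by = ∈-filter⁺ (λ w → T? (Graph.adj G b w)) (∈-allFin y) (Equivalence.from T-≡ by)

  neighbour⁻ : ∀ {b y} → y ∈ neighbours G b → Adj b y
  neighbour⁻ {b} y∈ = Equivalence.to T-≡ (proj₂ (∈-filter⁻ (λ w → T? (Graph.adj G b w)) {xs = allFin n} y∈))

  forward : V → V → List V
  forward a b = filter (λ y → ¬? (y ≟ a)) (neighbours G b)

  -- Regularity: b has k neighbours, one of which is a.
  forward-length : ∀ a b → Adj b a → length (forward a b) ≤ k ∸ 1
  forward-length a b ba = subst (λ K → length (forward a b) ≤ K ∸ 1) (regular b)
    (∸-monoˡ-≤ 1 (filter-notAll (λ y → ¬? (y ≟ a)) (neighbours G b)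
      (Any.map (λ a≡y y≢a → y≢a (sym a≡y)) (neighbour⁺ ba))))

  nbWalks : V → V → ℕ → List (List V)
  nbWalks a b zero    = [ [] ]
  nbWalks a b (suc m) = concatMap (λ y → map (y ∷_) (nbWalks b y m)) (forward a b)

  nbWalks-complete : ∀ a b ys → NonBacktracking a b ys → ys ∈ nbWalks a b (length ys)
  nbWalks-complete a b []       _               = here refl
  nbWalks-complete a b (y ∷ ys) (by , y≢a , nb) =
    ∈-concatMap⁺ (λ y → map (y ∷_) (nbWalks b y (length ys)))
      (Any.map (λ { refl → ∈-map⁺ (y ∷_) (nbWalks-complete b y ys nb) })
               (∈-filter⁺ (λ y → ¬? (y ≟ a)) (neighbour⁺ by) y≢a))

  -- Each step has at most k - 1 choices.
  nbWalks-length : ∀ m a b → Adj b a → length (nbWalks a b m) ≤ (k ∸ 1) ^ m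
  nbWalks-length zero    a b _  = ≤-refl
  nbWalks-length (suc m) a b ba =
    ≤-trans (length-concatMap-≤ (λ y → map (y ∷_) (nbWalks b y m)) (forward a b) step-bound)
            (*-monoˡ-≤ ((k ∸ 1) ^ m) (forward-length a b ba))
    where
      step-bound : ∀ {y} → y ∈ forward a b → length (map (y ∷_) (nbWalks b y m)) ≤ (k ∸ 1) ^ m
      step-bound {y} y∈ = ≤-trans (≤-reflexive (length-map (y ∷_) (nbWalks b y m)))
        (nbWalks-length m b y (adj-sym (neighbour⁻ (proj₁ (∈-filter⁻ (λ y → ¬? (y ≟ a)) y∈)))))

module Enumeration {n : ℕ} (G : Graph n) where

  allLists-unique : ∀ m → Unique (allLists G m)
  allLists-unique zero    = [] ∷ []
  allLists-unique (suc m) =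
    Unique.concat⁺ (All.map⁺ (tabulate λ _ → Unique.map⁺ ∷-injectiveʳ (allLists-unique m)))
                   (AllPairs.map⁺ (AllPairs.map disjoint (Unique.allFin⁺ n)))
    where
      disjoint : ∀ {x y} → x ≢ y → Disjoint (map (x ∷_) (allLists G m)) (map (y ∷_) (allLists G m))
      disjoint x≢y (t∈ , t∈')
        with _ , _ , refl ← ∈-map⁻ (_ ∷_) t∈
        with _ , _ , eq ← ∈-map⁻ (_ ∷_) t∈' = x≢y (∷-injectiveˡ eq)

  allLists-length : ∀ m {xs} → xs ∈ allLists G m → length xs ≡ m
  allLists-length zero    (here refl) = refl
  allLists-length (suc m) xs∈
    with _ , xs∈′ ← satisfied (∈-concatMap⁻ (λ x → map (x ∷_) (allLists G m)) {xs = allFin n} xs∈)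
    with _ , ys∈ , refl ← ∈-map⁻ (_ ∷_) xs∈′ = cong suc (allLists-length m ys∈)

module Bound {n : ℕ} (G : Graph n) (k d' : ℕ) (regular : Regular G k)
  (girth : ∀ ℓ xs → ℓ < 2 * suc d' + 1 → ¬ IsCycle G ℓ xs) where
  open Paths G
  open Girth G d' girth
  open Counting G k regular
  open Enumeration G

  -- If w is at distance d + r from b and d + r + 1 from a, then a list of distinct girth
  -- cycles through ab has fewer than (k - 1)^d entries: their first d vertices after b are
  -- distinct non-backtracking walks, and the start of a shortest walk from b to w is
  -- another one.
  girth-cycles-bound′ : ∀ {a b w} r (L : List (List V)) → Unique L → All (GirthCycle a b) L →
    Adj b a → Dist G b w (d + r) → Dist G a w (suc (d + r)) → length L < (k ∸ 1) ^ d
  girth-cycles-bound′ {a} {b} {w} r L unique cycles ba (to-w , b-far) (_ , a-far)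
    with ys , nb , len , rest ← geodesic-prefix d r to-w b-far a-far = begin-strict
    length L                 ≡⟨ sym (length-map (take d) L) ⟩
    length (map (take d) L)  <⟨ unique-⊂-length prefixes-unique prefixes-nb geodesic-nb geodesic-new ⟩
    length (nbWalks a b d)   ≤⟨ nbWalks-length d a b ba ⟩
    (k ∸ 1) ^ d              ∎
    where
      open ≤-Reasoning

      prefixes-unique : Unique (map (take d) L)
      prefixes-unique = unique-map-on (take d)
        (λ x∈ y∈ → prefix-determines (lookup cycles x∈) (lookup cycles y∈)) unique

      prefixes-nb : map (take d) L ⊆ nbWalks a b d
      prefixes-nb t∈ with ws , ws∈ , refl ← ∈-map⁻ (take d) t∈ =
        subst (λ m → take d ws ∈ nbWalks a b m) (prefix-length (lookup cycles ws∈))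
          (nbWalks-complete a b _ (prefix-nonbacktracking (lookup cycles ws∈)))

      geodesic-nb : ys ∈ nbWalks a b d
      geodesic-nb = subst (λ m → ys ∈ nbWalks a b m) len (nbWalks-complete a b ys nb)

      -- Otherwise a reaches w in d + r steps through the opposite vertex of a girth cycle.
      geodesic-new : ys ∉ map (take d) L
      geodesic-new ys∈ with ws , ws∈ , ys≡ ← ∈-map⁻ (take d) ys∈ =
        a-far (d + r) ≤-refl (walk-++ (opposite-reachable (lookup cycles ws∈))
                                     (subst (λ P → Walk G (endpoint b P) w r) ys≡ rest))

  girth-cycles-bound : ∀ {a b w i} (L : List (List V)) → Unique L → All (GirthCycle a b) L →
    Adj b a → Dist G b w i → Dist G a w (i + 1) → d ≤ i → length L < (k ∸ 1) ^ d
  girth-cycles-bound {a} {b} {w} {i} L unique cycles ba to-b to-a d≤i =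
    girth-cycles-bound′ (i ∸ d) L unique cycles ba
      (subst (Dist G b w) (sym i≡) to-b) (subst (Dist G a w) (trans (+-comm i 1) (cong suc (sym i≡))) to-a)
    where
      i≡ : d + (i ∸ d) ≡ i
      i≡ = m+[n∸m]≡n d≤i

  -- The girth cycles through uv counted by eps.
  throughEdge : V → V → List (List V)
  throughEdge u v = filter (λ ws → T? (isCycleB G (u ∷ v ∷ ws))) (allLists G (2 * d + 1 ∸ 2))

  throughEdge-unique : ∀ u v → Unique (throughEdge u v)
  throughEdge-unique u v = Unique.filter⁺ (λ ws → T? (isCycleB G (u ∷ v ∷ ws))) (allLists-unique (2 * d + 1 ∸ 2))

  throughEdge-girth : ∀ u v → All (GirthCycle u v) (throughEdge u v)
  throughEdge-girth u v = tabulate λ ws∈ →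
    let (ws∈all , t) = ∈-filter⁻ (λ ws → T? (isCycleB G (u ∷ v ∷ ws))) {xs = allLists G (2 * d + 1 ∸ 2)} ws∈ in
    cycle⁻ u (v ∷ _) t , trans (allLists-length _ ws∈all) tail-length
    where
      tail-length : 2 * d + 1 ∸ 2 ≡ d + d'
      tail-length = trans (cong (_∸ 2) (shape d')) (m+n∸n≡m (d + d') 2)
        where
          shape : ∀ e → 2 * suc e + 1 ≡ (suc e + e) + 2
          shape = solve-∀

-- For w ∈ D^{i+1}_i(u,v) the bound applies to the girth cycles through uv read from v,
-- for w ∈ D^i_{i+1}(u,v) to the same cycles read backwards from u; either way
-- ε(uv) < (k-1)^d.  Girth 1 (d = 0) is impossible, cycles having length at least 3.
lemma2p3 : ∀ {n} (G : Graph n) (k d : ℕ) (a : List ℕ)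
    → Regular G k
    → GirthRegularWith G (2 * d + 1) a
    → last a ≡ just ((k ∸ 1) ^ d)
    → (u v : Fin n) → Graph.adj G u v ≡ true
    → eps G (2 * d + 1) u v ≡ (k ∸ 1) ^ d
    → ∀ i → d ≤ i → ∀ w → (¬ InD G i (i + 1) u v w) × (¬ InD G (i + 1) i u v w)
lemma2p3 G k zero     _ _       (((_ , (s≤s () , _)) , _) , _) _ u v uv eps≡ i d≤i w
lemma2p3 G k (suc d') _ regular ((_ , girth) , _)             _ u v uv eps≡ i d≤i w =
  (λ (near-u , far-v) → fewer (subst (_< (k ∸ 1) ^ suc d') (length-map reverse (throughEdge u v))
    (girth-cycles-bound (map reverse (throughEdge u v))
      (Unique.map⁺ reverse-injective (throughEdge-unique u v))
      (All.map⁺ (tabulate λ ws∈ → girth-cycle-reverse (lookup (throughEdge-girth u v) ws∈)))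
      uv near-u far-v d≤i))) ,
  (λ (far-u , near-v) → fewer
    (girth-cycles-bound (throughEdge u v) (throughEdge-unique u v) (throughEdge-girth u v)
      (adj-sym uv) near-v far-u d≤i))
  where
    open Paths G
    open Girth G d' girth
    open Bound G k d' regular girth

    fewer : eps G (2 * suc d' + 1) u v < (k ∸ 1) ^ suc d' → ⊥
    fewer = <-irrefl eps≡
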